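{- Let $\mathcal{T}$ be a $\Sigma_1$-theory. If $\mathcal{T}$ is strongly finitely witnessable, then its natural density $\mu(\mathcal{T})$ is well-defined and equal to $0$ or $1$.
   Context: $\Sigma_1$ is the one-sorted first-order signature with no function or predicate symbols other than equality. Interpretations have non-empty domains and assign values to all variables; a theory is the class of all interpretations satisfying a given set of sentences. $\mathrm{Spec}(\mathcal{T})$ is the set of finite cardinalities of domains of $\mathcal{T}$-interpretations, $\mathrm{Spec}_n(\mathcal{T})=\mathrm{Spec}(\mathcal{T})\cap\{1,\dots,n\}$, $\mu(\mathcal{T})=\lim_{n\to\infty}|\mathrm{Spec}_n(\mathcal{T})|/n$. For a finite set of variables $V$ and an equivalence relation $E$ on $V$, the arrangement $\delta_V^E$ is $\bigwedge_{xEy}(x=y)\wedge\bigwedge_{\neg(xEy)}\neg(x=y)$. $\mathcal{T}$ is strongly finitely witnessable if there is a computable function $wit$ from quantifier-free formulas to quantifier-free formulas such that for every quantifier-free $\phi$: (I) $\phi$ and $\exists\vec{x}\,wit(\phi)$ are $\mathcal{T}$-equivalent, where $\vec{x}=vars(wit(\phi))\setminus vars(\phi)$; and (II*) for every finite set of variables $V$ and arrangement $\delta_V$ on $V$, if $wit(\phi)\wedge\delta_V$ is $\mathcal{T}$-satisfiable then there is a $\mathcal{T}$-interpretation $\mathcal{A}$ satisfying it whose domain equals the set of values in $\mathcal{A}$ of the variables of $wit(\phi)\wedge\delta_V$. -}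

module Defs where

open import Level using (Level; _⊔_; Setω) renaming (suc to lsuc; zero to lzero)
open import Data.Nat as ℕ using (ℕ; zero; suc; _≟_; _≤_)
open import Data.Fin using (Fin)
open import Data.List using (List; []; _∷_; _++_; filter; foldr; map; concatMap)
open import Data.List.Membership.DecPropositional _≟_ using (_∈?_)
open import Data.List.Membership.Propositional using (_∈_)
open import Data.Product using (Σ; ∃; _×_; _,_)
open import Data.Sum using (_⊎_)
open import Data.Empty using (⊥)
open import Data.Unit using (⊤)
open import Data.Integer using (+_)
open import Data.Rational as ℚ using (ℚ; _/_; ∣_∣; _-_; 0ℚ; 1ℚ; _<_)
open import Relation.Nullary using (¬_; Dec; yes; no)
open import Relation.Nullary.Decidable using (¬?)
open import Relation.Binary.PropositionalEquality using (_≡_)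
open import Function.Bundles using (_↔_)

-- Excluded middle (classical metatheory of the paper), at every level.
LEM : Setω
LEM = ∀ {ℓ} (A : Set ℓ) → Dec A

-- Syntax of first-order formulas over Σ₁ (only equality); variables are ℕ.

data Formula : Set where
  _≐_  : ℕ → ℕ → Formula
  ⊤f   : Formula
  ⊥f   : Formula
  ¬f_  : Formula → Formula
  _∧f_ : Formula → Formula → Formula
  _∨f_ : Formula → Formula → Formula
  _⇒f_ : Formula → Formula → Formula
  ∀f   : ℕ → Formula → Formula
  ∃f   : ℕ → Formula → Formula

data QF : Formula → Set where
  qf-eq  : ∀ x y → QF (x ≐ y)
  qf-⊤   : QF ⊤f
  qf-⊥   : QF ⊥f
  qf-¬   : ∀ {φ} → QF φ → QF (¬f φ)
  qf-∧   : ∀ {φ ψ} → QF φ → QF ψ → QF (φ ∧f ψ)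
  qf-∨   : ∀ {φ ψ} → QF φ → QF ψ → QF (φ ∨f ψ)
  qf-⇒   : ∀ {φ ψ} → QF φ → QF ψ → QF (φ ⇒f ψ)

vars : Formula → List ℕ
vars (x ≐ y)  = x ∷ y ∷ []
vars ⊤f       = []
vars ⊥f       = []
vars (¬f φ)   = vars φ
vars (φ ∧f ψ) = vars φ ++ vars ψ
vars (φ ∨f ψ) = vars φ ++ vars ψ
vars (φ ⇒f ψ) = vars φ ++ vars ψ
vars (∀f x φ) = x ∷ vars φ
vars (∃f x φ) = x ∷ vars φ

remove : ℕ → List ℕ → List ℕ
remove x = filter (λ y → ¬? (y ≟ x))

fv : Formula → List ℕ
fv (x ≐ y)  = x ∷ y ∷ []
fv ⊤f       = []
fv ⊥f       = []
fv (¬f φ)   = fv φ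
fv (φ ∧f ψ) = fv φ ++ fv ψ
fv (φ ∨f ψ) = fv φ ++ fv ψ
fv (φ ⇒f ψ) = fv φ ++ fv ψ
fv (∀f x φ) = remove x (fv φ)
fv (∃f x φ) = remove x (fv φ)

Sentence : Formula → Set
Sentence φ = fv φ ≡ []

exists* : List ℕ → Formula → Formula
exists* xs φ = foldr ∃f φ xs

_∖_ : List ℕ → List ℕ → List ℕ
xs ∖ ys = filter (λ x → ¬? (x ∈? ys)) xs

-- Semantics.  An interpretation: a domain and an assignment of all
-- variables (the assignment makes the domain non-empty).

record Interp : Set₁ where
  field
    Dom : Set
    val : ℕ → Dom
open Interp public

update : (A : Interp) → ℕ → Dom A → Interp
Dom (update A x d) = Dom A
val (update A x d) y with y ≟ x
... | yes _ = d
... | no  _ = val A y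

_⊨_ : Interp → Formula → Set
A ⊨ (x ≐ y)  = val A x ≡ val A y
A ⊨ ⊤f       = ⊤
A ⊨ ⊥f       = ⊥
A ⊨ (¬f φ)   = ¬ (A ⊨ φ)
A ⊨ (φ ∧f ψ) = (A ⊨ φ) × (A ⊨ ψ)
A ⊨ (φ ∨f ψ) = (A ⊨ φ) ⊎ (A ⊨ ψ)
A ⊨ (φ ⇒f ψ) = (A ⊨ φ) → (A ⊨ ψ)
A ⊨ (∀f x φ) = (d : Dom A) → update A x d ⊨ φ
A ⊨ (∃f x φ) = Σ (Dom A) λ d → update A x d ⊨ φ

record Theory : Set₁ where
  field
    Ax        : Formula → Set
    sentences : ∀ φ → Ax φ → Sentence φ
open Theory public

IsModel : Theory → Interp → Set
IsModel T A = ∀ φ → Ax T φ → A ⊨ φ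

T-satisfiable : Theory → Formula → Set₁
T-satisfiable T φ = Σ Interp λ A → IsModel T A × (A ⊨ φ)

T-equivalent : Theory → Formula → Formula → Set₁
T-equivalent T φ ψ = ∀ (A : Interp) → IsModel T A → ((A ⊨ φ → A ⊨ ψ) × (A ⊨ ψ → A ⊨ φ))

-- An equivalence relation E on a finite set V of variables
-- is given as the kernel of a labelling f : ℕ → ℕ restricted to V (every
-- equivalence relation on a finite set arises this way).

lit : (ℕ → ℕ) → ℕ → ℕ → Formula
lit f x y with f x ≟ f y
... | yes _ = x ≐ y
... | no  _ = ¬f (x ≐ y)

bigAnd : List Formula → Formula
bigAnd = foldr _∧f_ ⊤f

arrangement : List ℕ → (ℕ → ℕ) → Formula
arrangement V f = bigAnd (concatMap (λ x → map (lit f x) V) V)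

record StronglyFinitelyWitnessable (T : Theory) : Set₁ where
  field
    wit    : Formula → Formula
    wit-qf : ∀ φ → QF φ → QF (wit φ)
    wit-equiv : ∀ φ → QF φ →
      T-equivalent T φ (exists* (vars (wit φ) ∖ vars φ) (wit φ))
    wit-min : ∀ φ → QF φ → (V : List ℕ) (E : ℕ → ℕ) →
      T-satisfiable T (wit φ ∧f arrangement V E) →
      Σ Interp λ A → IsModel T A × (A ⊨ (wit φ ∧f arrangement V E)) ×
        (∀ (d : Dom A) → Σ ℕ λ x → (x ∈ vars (wit φ ∧f arrangement V E)) × (val A x ≡ d))

InSpec : Theory → ℕ → Set₁
InSpec T n = Σ Interp λ A → IsModel T A × (Dom A ↔ Fin n)

specCount : LEM → Theory → ℕ → ℕ
specCount lem T zero = zero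
specCount lem T (suc n) with lem (InSpec T (suc n))
... | yes _ = suc (specCount lem T n)
... | no  _ = specCount lem T n

-- |Spec_n(T)| / n, indexed by m with n = m + 1
densitySeq : LEM → Theory → ℕ → ℚ
densitySeq lem T m = (+ specCount lem T (suc m)) / suc m

DensityIs : LEM → Theory → ℚ → Set
DensityIs lem T r = ∀ (ε : ℚ) → 0ℚ < ε →
  Σ ℕ λ N → ∀ m → N ≤ m → ∣ densitySeq lem T m - r ∣ ℚ.≤ ε

-- Let ψ = wit ⊤ and w = |vars ψ|.  A model of size n satisfies ψ under some
-- assignment; add fresh variables naming every element and go through them one
-- at a time: the number of values taken on vars ψ plus the fresh variables seen
-- so far starts at most w and grows by at most one per variable, so for
-- w ≤ k ≤ n it equals k at some point.  The arrangement of those variables has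
-- exactly k classes, and (II*) turns it into a model of size exactly k.  Hence
-- above w the spectrum is downward closed: either it is finite, and the density
-- is 0, or it contains every k ≥ w, and the density is 1.
module Submission where

open import Defs
open import Data.Nat as ℕ using (ℕ; zero; suc; _≟_; _≤_; _<_; _+_; _∸_; _<?_; z≤n; s≤s)
import Data.Nat.Properties as ℕ
open import Data.Integer as ℤ using (+_; +[1+_]; -[1+_]; _⊖_)
import Data.Integer.Properties as ℤ
open import Data.Rational as ℚ using (ℚ; mkℚ; _/_; toℚᵘ; 0ℚ; 1ℚ)
import Data.Rational.Properties as ℚ
open import Data.Rational.Unnormalised as ℚᵘ using (mkℚᵘ; *≤*; *≡*)
import Data.Rational.Unnormalised.Properties as ℚᵘ
open import Data.Fin using (Fin; toℕ; fromℕ<)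
open import Data.Fin.Properties using (toℕ-injective; toℕ-fromℕ<; toℕ<n; injective⇒≤)
open import Data.List
  using (List; []; _∷_; _++_; length; map; concatMap; cartesianProductWith; applyUpTo)
open import Data.List.Extrema.Nat using (max; xs≤max)
open import Data.List.Membership.Propositional using (_∈_)
open import Data.List.Membership.Propositional.Properties
  using ( ∈-++⁺ˡ; ∈-++⁺ʳ; ∈-++⁻; ∈-filter⁺; ∈-filter⁻; ∈-applyUpTo⁺
        ; ∈-cartesianProductWith⁺; ∈-cartesianProductWith⁻ )
open import Data.List.Relation.Binary.Subset.Propositional using (_⊆_)
open import Data.List.Relation.Binary.Subset.Propositional.Properties using (++⁺)
import Data.List.Relation.Unary.All as All
open import Data.List.Relation.Unary.Any using (here; there)
open import Data.List.Relation.Unary.Any.Properties using (¬Any[])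
open import Data.Product using (∃; ∃₂; _×_; _,_; proj₁; proj₂)
open import Data.Sum as Sum using (_⊎_; inj₁; inj₂; [_,_]′)
open import Data.Unit using (tt)
open import Function using (_∘_; id)
open import Function.Bundles using (_⇔_; mk⇔; Equivalence; _↔_; Inverse; mk↔ₛ′; Injection)
open import Function.Properties.Inverse using (↔-sym; ↔-trans; ↔⇒↣)
open import Relation.Nullary using (¬_; yes; no; contradiction)
open import Relation.Nullary.Decidable using (decidable-stable)
open import Relation.Binary.PropositionalEquality
  using (_≡_; _≢_; refl; sym; trans; cong; subst; subst₂)

interp : (D : Set) → (ℕ → D) → Interp
interp D v = record { Dom = D ; val = v }

fv⊆vars : ∀ φ → fv φ ⊆ vars φ
fv⊆vars (x ≐ y)  = id
fv⊆vars ⊤f       = id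
fv⊆vars ⊥f       = id
fv⊆vars (¬f φ)   = fv⊆vars φ
fv⊆vars (φ ∧f ψ) = ++⁺ (fv⊆vars φ) (fv⊆vars ψ)
fv⊆vars (φ ∨f ψ) = ++⁺ (fv⊆vars φ) (fv⊆vars ψ)
fv⊆vars (φ ⇒f ψ) = ++⁺ (fv⊆vars φ) (fv⊆vars ψ)
fv⊆vars (∀f x φ) = there ∘ fv⊆vars φ ∘ proj₁ ∘ ∈-filter⁻ _
fv⊆vars (∃f x φ) = there ∘ fv⊆vars φ ∘ proj₁ ∘ ∈-filter⁻ _

update-agree : ∀ {D} {v w : ℕ → D} x d {xs} → (∀ {y} → y ∈ remove x xs → v y ≡ w y) →
  ∀ {y} → y ∈ xs → val (update (interp D v) x d) y ≡ val (update (interp D w) x d) y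
update-agree x d agree {y} y∈ with y ≟ x
... | yes _   = refl
... | no y≢x = agree (∈-filter⁺ _ y∈ y≢x)

⊨-coincidence : ∀ φ {D} {v w : ℕ → D} → (∀ {x} → x ∈ fv φ → v x ≡ w x) →
  interp D v ⊨ φ → interp D w ⊨ φ
⊨-coincidence (x ≐ y)  agree s       =
  trans (sym (agree (here refl))) (trans s (agree (there (here refl))))
⊨-coincidence ⊤f       agree s       = s
⊨-coincidence ⊥f       agree s       = s
⊨-coincidence (¬f φ)   agree s       = s ∘ ⊨-coincidence φ (sym ∘ agree)
⊨-coincidence (φ ∧f ψ) agree (s , t) =
  ⊨-coincidence φ (agree ∘ ∈-++⁺ˡ) s , ⊨-coincidence ψ (agree ∘ ∈-++⁺ʳ (fv φ)) t
⊨-coincidence (φ ∨f ψ) agree         =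
  Sum.map (⊨-coincidence φ (agree ∘ ∈-++⁺ˡ)) (⊨-coincidence ψ (agree ∘ ∈-++⁺ʳ (fv φ)))
⊨-coincidence (φ ⇒f ψ) agree s       =
  ⊨-coincidence ψ (agree ∘ ∈-++⁺ʳ (fv φ)) ∘ s ∘ ⊨-coincidence φ (sym ∘ agree ∘ ∈-++⁺ˡ)
⊨-coincidence (∀f x φ) agree s d     = ⊨-coincidence φ (update-agree x d agree) (s d)
⊨-coincidence (∃f x φ) agree (d , s) = d , ⊨-coincidence φ (update-agree x d agree) s

IsModel-reassign : ∀ T (A : Interp) → IsModel T A → (w : ℕ → Dom A) → IsModel T (interp (Dom A) w)
IsModel-reassign T A model w φ ax =
  ⊨-coincidence φ (λ x∈ → contradiction (subst (_ ∈_) (sentences T φ ax) x∈) ¬Any[]) (model φ ax)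

⊨-exists* : ∀ xs {φ} (A : Interp) → A ⊨ exists* xs φ →
  ∃ λ (w : ℕ → Dom A) → interp (Dom A) w ⊨ φ
⊨-exists* []       A s       = val A , s
⊨-exists* (x ∷ xs) A (d , s) = ⊨-exists* xs (update A x d) s

⊨-bigAnd⁺ : ∀ {A} φs → (∀ {φ} → φ ∈ φs → A ⊨ φ) → A ⊨ bigAnd φs
⊨-bigAnd⁺ []       _     = tt
⊨-bigAnd⁺ (φ ∷ φs) holds = holds (here refl) , ⊨-bigAnd⁺ φs (holds ∘ there)

⊨-bigAnd⁻ : ∀ {A φ φs} → A ⊨ bigAnd φs → φ ∈ φs → A ⊨ φ
⊨-bigAnd⁻ (s , _) (here refl) = s
⊨-bigAnd⁻ (_ , s) (there φ∈) = ⊨-bigAnd⁻ s φ∈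

vars-bigAnd : ∀ {z} φs → z ∈ vars (bigAnd φs) → ∃ λ φ → φ ∈ φs × z ∈ vars φ
vars-bigAnd (φ ∷ φs) z∈ with ∈-++⁻ (vars φ) z∈
... | inj₁ z∈φ  = φ , here refl , z∈φ
... | inj₂ z∈φs = let ψ , ψ∈ , z∈ψ = vars-bigAnd φs z∈φs in ψ , there ψ∈ , z∈ψ

⊨-lit⁺ : ∀ {A} E x y → (val A x ≡ val A y ⇔ E x ≡ E y) → A ⊨ lit E x y
⊨-lit⁺ E x y kernel with E x ≟ E y
... | yes Ex≡Ey = Equivalence.from kernel Ex≡Ey
... | no  Ex≢Ey = Ex≢Ey ∘ Equivalence.to kernel

⊨-lit⁻ : ∀ {A} E x y → A ⊨ lit E x y → (val A x ≡ val A y ⇔ E x ≡ E y)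
⊨-lit⁻ E x y s with E x ≟ E y
... | yes Ex≡Ey = mk⇔ (λ _ → Ex≡Ey) (λ _ → s)
... | no  Ex≢Ey = mk⇔ (λ eq → contradiction eq s) (λ eq → contradiction eq Ex≢Ey)

vars-lit : ∀ E x y → vars (lit E x y) ≡ x ∷ y ∷ []
vars-lit E x y with E x ≟ E y
... | yes _ = refl
... | no  _ = refl

concatMap-map≡cartesianProductWith : ∀ {A B C : Set} (f : A → B → C) xs ys →
  concatMap (λ x → map (f x) ys) xs ≡ cartesianProductWith f xs ys
concatMap-map≡cartesianProductWith f []       ys = refl
concatMap-map≡cartesianProductWith f (x ∷ xs) ys =
  cong (map (f x) ys ++_) (concatMap-map≡cartesianProductWith f xs ys)

module _ {V : List ℕ} {E : ℕ → ℕ} where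

  private
    literals : List Formula
    literals = concatMap (λ x → map (lit E x) V) V

    literals≡ : literals ≡ cartesianProductWith (lit E) V V
    literals≡ = concatMap-map≡cartesianProductWith (lit E) V V

    ∈-literals⁺ : ∀ {x y} → x ∈ V → y ∈ V → lit E x y ∈ literals
    ∈-literals⁺ x∈ y∈ = subst (_ ∈_) (sym literals≡) (∈-cartesianProductWith⁺ (lit E) x∈ y∈)

    ∈-literals⁻ : ∀ {φ} → φ ∈ literals → ∃₂ λ x y → x ∈ V × y ∈ V × φ ≡ lit E x y
    ∈-literals⁻ φ∈ = ∈-cartesianProductWith⁻ (lit E) V V (subst (_ ∈_) literals≡ φ∈)

  ⊨-arrangement⁺ : ∀ {A} → (∀ {x y} → x ∈ V → y ∈ V → val A x ≡ val A y ⇔ E x ≡ E y) →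
    A ⊨ arrangement V E
  ⊨-arrangement⁺ kernel = ⊨-bigAnd⁺ literals λ φ∈ →
    let x , y , x∈ , y∈ , φ≡ = ∈-literals⁻ φ∈
    in subst (_ ⊨_) (sym φ≡) (⊨-lit⁺ E x y (kernel x∈ y∈))

  ⊨-arrangement⁻ : ∀ {A x y} → A ⊨ arrangement V E → x ∈ V → y ∈ V →
    val A x ≡ val A y ⇔ E x ≡ E y
  ⊨-arrangement⁻ {x = x} {y} s x∈ y∈ = ⊨-lit⁻ E x y (⊨-bigAnd⁻ s (∈-literals⁺ x∈ y∈))

  vars-arrangement : vars (arrangement V E) ⊆ V
  vars-arrangement z∈ with vars-bigAnd literals z∈
  ... | φ , φ∈ , z∈φ with ∈-literals⁻ φ∈
  ... | x , y , x∈ , y∈ , refl with subst (_ ∈_) (vars-lit E x y) z∈φ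
  ...   | here refl         = x∈
  ...   | there (here refl) = y∈

record Labelling {D : Set} (v : ℕ → D) (V : List ℕ) (s : ℕ) : Set where
  field
    label        : ℕ → ℕ
    label<       : ∀ {x} → x ∈ V → label x < s
    label-onto   : ∀ {i} → i < s → ∃ λ x → x ∈ V × label x ≡ i
    label-kernel : ∀ {x y} → x ∈ V → y ∈ V → v x ≡ v y ⇔ label x ≡ label y
open Labelling

Labelling⇒↔ : ∀ {D V k} {v : ℕ → D} → Labelling v V k → (∀ d → ∃ λ x → x ∈ V × v x ≡ d) →
  D ↔ Fin k
Labelling⇒↔ {D} {V} {k} {v} L covers = mk↔ₛ′ to from to∘from from∘to
  where
  to : D → Fin k
  to d with covers d
  ... | _ , x∈ , _ = fromℕ< (label< L x∈)

  from : Fin k → D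
  from i = v (proj₁ (label-onto L (toℕ<n i)))

  to∘from : ∀ i → to (from i) ≡ i
  to∘from i with label-onto L (toℕ<n i)
  ... | y , y∈ , ly≡i with covers (v y)
  ...   | x , x∈ , vx≡vy = toℕ-injective
    (trans (toℕ-fromℕ< _) (trans (Equivalence.to (label-kernel L x∈ y∈) vx≡vy) ly≡i))

  from∘to : ∀ d → from (to d) ≡ d
  from∘to d with covers d
  ... | x , x∈ , vx≡d with label-onto L (toℕ<n (fromℕ< (label< L x∈)))
  ...   | y , y∈ , ly≡i =
    trans (Equivalence.from (label-kernel L y∈ x∈) (trans ly≡i (toℕ-fromℕ< _))) vx≡d

_[_≔_] : (ℕ → ℕ) → ℕ → ℕ → ℕ → ℕ
(f [ x ≔ a ]) y with y ≟ x
... | yes _ = a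
... | no  _ = f y

[≔]-same : ∀ f x a → (f [ x ≔ a ]) x ≡ a
[≔]-same f x a with x ≟ x
... | yes _   = refl
... | no x≢x = contradiction refl x≢x

[≔]-other : ∀ f {x y} a → y ≢ x → (f [ x ≔ a ]) y ≡ f y
[≔]-other f {x} {y} a y≢x with y ≟ x
... | yes y≡x = contradiction y≡x y≢x
... | no  _   = refl

∈-∷-view : ∀ {x y : ℕ} {V} → y ∈ x ∷ V → y ≡ x ⊎ (y ≢ x × y ∈ V)
∈-∷-view         (here y≡x) = inj₁ y≡x
∈-∷-view {x} {y} (there y∈) with y ≟ x
... | yes y≡x = inj₁ y≡x
... | no  y≢x = inj₂ (y≢x , y∈)

module _ {D : Set} {v : ℕ → D} where

  Labelling-[] : Labelling v [] 0
  Labelling-[] = record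
    { label = λ _ → 0 ; label< = λ () ; label-onto = λ () ; label-kernel = λ () }

  Labelling-∷-old : ∀ {V s x z} → Labelling v V s → z ∈ V → v z ≡ v x → Labelling v (x ∷ V) s
  Labelling-∷-old {V} {s} {x} {z} L z∈ vz≡vx = record
    { label = label′ ; label< = bound ; label-onto = onto ; label-kernel = kernel }
    where
    label′ : ℕ → ℕ
    label′ = label L [ x ≔ label L z ]

    representative : ∀ {y} → y ∈ x ∷ V → ∃ λ y′ → y′ ∈ V × v y′ ≡ v y × label′ y ≡ label L y′
    representative y∈ with ∈-∷-view y∈
    ... | inj₁ refl        = z , z∈ , vz≡vx , [≔]-same (label L) x (label L z)
    ... | inj₂ (y≢x , y∈V) = _ , y∈V , refl , [≔]-other (label L) (label L z) y≢x

    bound : ∀ {y} → y ∈ x ∷ V → label′ y < s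
    bound y∈ = let y′ , y′∈ , _ , ly≡ly′ = representative y∈ in subst (_< s) (sym ly≡ly′) (label< L y′∈)

    onto : ∀ {i} → i < s → ∃ λ y → y ∈ x ∷ V × label′ y ≡ i
    onto i<s with label-onto L i<s
    ... | y , y∈ , ly≡i with representative (there y∈)
    ...   | y′ , y′∈ , vy′≡vy , ly≡ly′ =
      y , there y∈ , trans ly≡ly′ (trans (Equivalence.to (label-kernel L y′∈ y∈) vy′≡vy) ly≡i)

    kernel : ∀ {a b} → a ∈ x ∷ V → b ∈ x ∷ V → v a ≡ v b ⇔ label′ a ≡ label′ b
    kernel {a} {b} a∈ b∈ with representative a∈ | representative b∈
    ... | a′ , a′∈ , va′≡va , la≡la′ | b′ , b′∈ , vb′≡vb , lb≡lb′ =
      subst₂ (λ p q → p ≡ q ⇔ label′ a ≡ label′ b) va′≡va vb′≡vb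
        (subst₂ (λ i j → v a′ ≡ v b′ ⇔ i ≡ j) (sym la≡la′) (sym lb≡lb′) (label-kernel L a′∈ b′∈))

  Labelling-∷-new : ∀ {V s x} → Labelling v V s → ¬ (∃ λ z → z ∈ V × v z ≡ v x) →
    Labelling v (x ∷ V) (suc s)
  Labelling-∷-new {V} {s} {x} L x-new = record
    { label = label′ ; label< = bound ; label-onto = onto ; label-kernel = kernel }
    where
    label′ : ℕ → ℕ
    label′ = label L [ x ≔ s ]

    old : ∀ {y} → y ∈ V → label′ y ≡ label L y
    old y∈ = [≔]-other (label L) s λ { refl → x-new (x , y∈ , refl) }

    apart : ∀ {y} → y ∈ V → ¬ v x ≡ v y × ¬ label′ x ≡ label′ y
    apart y∈ =
      (λ vx≡vy → x-new (_ , y∈ , sym vx≡vy)) ,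
      (λ lx≡ly → ℕ.<-irrefl (trans (sym (old y∈)) (trans (sym lx≡ly) ([≔]-same (label L) x s)))
                            (label< L y∈))

    bound : ∀ {y} → y ∈ x ∷ V → label′ y < suc s
    bound (here refl) = subst (_< suc s) (sym ([≔]-same (label L) x s)) (ℕ.n<1+n s)
    bound (there y∈)  = subst (_< suc s) (sym (old y∈)) (ℕ.m<n⇒m<1+n (label< L y∈))

    onto : ∀ {i} → i < suc s → ∃ λ y → y ∈ x ∷ V × label′ y ≡ i
    onto i<1+s with ℕ.m≤n⇒m<n∨m≡n (ℕ.≤-pred i<1+s)
    ... | inj₂ refl = x , here refl , [≔]-same (label L) x s
    ... | inj₁ i<s  = let y , y∈ , ly≡i = label-onto L i<s in y , there y∈ , trans (old y∈) ly≡i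

    neither : ∀ {P Q : Set} → ¬ P → ¬ Q → P ⇔ Q
    neither ¬p ¬q = mk⇔ (λ p → contradiction p ¬p) (λ q → contradiction q ¬q)

    kernel : ∀ {a b} → a ∈ x ∷ V → b ∈ x ∷ V → v a ≡ v b ⇔ label′ a ≡ label′ b
    kernel (here refl) (here refl) = mk⇔ (λ _ → refl) (λ _ → refl)
    kernel (here refl) (there b∈)  = let ¬v , ¬l = apart b∈ in neither ¬v ¬l
    kernel (there a∈)  (here refl) = let ¬v , ¬l = apart a∈ in neither (¬v ∘ sym) (¬l ∘ sym)
    kernel (there a∈)  (there b∈)  =
      subst₂ (λ i j → _ ⇔ i ≡ j) (sym (old a∈)) (sym (old b∈)) (label-kernel L a∈ b∈)

  Labelling-∷ : LEM → ∀ {V s} x → Labelling v V s →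
    Labelling v (x ∷ V) s ⊎ Labelling v (x ∷ V) (suc s)
  Labelling-∷ lem {V} x L with lem (∃ λ z → z ∈ V × v z ≡ v x)
  ... | yes (z , z∈ , vz≡vx) = inj₁ (Labelling-∷-old L z∈ vz≡vx)
  ... | no  x-new            = inj₂ (Labelling-∷-new L x-new)

  labelling : LEM → ∀ V → ∃ λ s → s ≤ length V × Labelling v V s
  labelling lem []      = 0 , z≤n , Labelling-[]
  labelling lem (x ∷ V) with labelling lem V
  ... | s , s≤ , L with Labelling-∷ lem x L
  ...   | inj₁ L′ = s , ℕ.m≤n⇒m≤1+n s≤ , L′
  ...   | inj₂ L′ = suc s , s≤s s≤ , L′

  -- Discrete intermediate value theorem: each added variable adds at most one value.
  labelling-reach : LEM → ∀ {V s k} rest → Labelling v V s → s ≤ k →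
    (∃ λ pre → Labelling v (pre ++ V) k) ⊎ (∃ λ t → t < k × Labelling v (rest ++ V) t)
  labelling-reach lem [] L s≤k with ℕ.m≤n⇒m<n∨m≡n s≤k
  ... | inj₁ s<k  = inj₂ (_ , s<k , L)
  ... | inj₂ refl = inj₁ ([] , L)
  labelling-reach lem (x ∷ rest) L s≤k with labelling-reach lem rest L s≤k
  ... | inj₁ reached = inj₁ reached
  ... | inj₂ (t , t<k , L′) with Labelling-∷ lem x L′
  ...   | inj₁ L″ = inj₂ (t , t<k , L″)
  ...   | inj₂ L″ with ℕ.m≤n⇒m<n∨m≡n t<k
  ...     | inj₁ 1+t<k = inj₂ (suc t , 1+t<k , L″)
  ...     | inj₂ refl  = inj₁ (x ∷ rest , L″)

  labelling-between : LEM → ∀ {k} V rest → length V ≤ k →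
    (∃ λ pre → Labelling v (pre ++ V) k) ⊎ (∃ λ t → t < k × Labelling v (rest ++ V) t)
  labelling-between lem V rest |V|≤k =
    let s , s≤|V| , L = labelling lem V in labelling-reach lem rest L (ℕ.≤-trans s≤|V| |V|≤k)

module _ {D : Set} {n : ℕ} (v : ℕ → D) (M : ℕ) (e : Fin n → D) where

  pad : ℕ → D
  pad x with x <? M
  ... | yes _ = v x
  ... | no  _ with x ∸ M <? n
  ...   | yes j<n = e (fromℕ< j<n)
  ...   | no  _   = v x

  pad-< : ∀ {x} → x < M → pad x ≡ v x
  pad-< {x} x<M with x <? M
  ... | yes _   = refl
  ... | no x≮M = contradiction x<M x≮M

  pad-+ : ∀ i → pad (M + toℕ i) ≡ e i
  pad-+ i with M + toℕ i <? M
  ... | yes M+i<M = contradiction M+i<M (ℕ.m+n≮m M (toℕ i))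
  ... | no  _ with M + toℕ i ∸ M <? n
  ...   | yes j<n = cong e (toℕ-injective (trans (toℕ-fromℕ< j<n) (ℕ.m+n∸m≡n M (toℕ i))))
  ...   | no  j≮n = contradiction (subst (_< n) (sym (ℕ.m+n∸m≡n M (toℕ i))) (toℕ<n i)) j≮n

module _ {T : Theory} (S : StronglyFinitelyWitnessable T) where
  open StronglyFinitelyWitnessable S

  witness-width : ℕ
  witness-width = length (vars (wit ⊤f))

  InSpec-labelled-witness : ∀ {φ V k D} {v : ℕ → D} → QF φ → vars (wit φ) ⊆ V →
    IsModel T (interp D v) → interp D v ⊨ wit φ → Labelling v V k → InSpec T k
  InSpec-labelled-witness {φ} {V} {k} {D} {v} qf wit⊆V model sat L
    with wit-min φ qf V (label L) (interp D v , model , sat , ⊨-arrangement⁺ (label-kernel L))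
  ... | A , A-model , (_ , A-arranged) , A-covered = A , A-model , Labelling⇒↔ L-in-A covers
    where
    L-in-A : Labelling (val A) V k
    L-in-A = record
      { label        = label L
      ; label<       = label< L
      ; label-onto   = label-onto L
      ; label-kernel = ⊨-arrangement⁻ A-arranged
      }

    covers : ∀ d → ∃ λ x → x ∈ V × val A x ≡ d
    covers d = let x , x∈ , Ax≡d = A-covered d in
      x , [ wit⊆V , vars-arrangement ]′ (∈-++⁻ _ x∈) , Ax≡d

  InSpec-interval : LEM → ∀ {n k} → witness-width ≤ k → k ≤ n → InSpec T n → InSpec T k
  InSpec-interval lem {n} {k} w≤k k≤n (B , B-model , B↔n) =
    [ (λ (pre , L) → InSpec-labelled-witness qf-⊤ (∈-++⁺ʳ pre {W}) model⁺ ψ-holds⁺ L)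
    , (λ (t , t<k , L) → contradiction (ℕ.≤-trans k≤n (n≤ L)) (ℕ.<⇒≱ t<k))
    ]′ (labelling-between lem W fresh w≤k)
    where
    open Inverse B↔n using (to; from; strictlyInverseʳ)
    W = vars (wit ⊤f)
    M = suc (max 0 W)

    witness : ∃ λ v → interp (Dom B) v ⊨ wit ⊤f
    witness = ⊨-exists* (W ∖ vars ⊤f) B (proj₁ (wit-equiv ⊤f qf-⊤ B B-model) tt)

    v⁺ : ℕ → Dom B
    v⁺ = pad (proj₁ witness) M from

    model⁺ : IsModel T (interp (Dom B) v⁺)
    model⁺ = IsModel-reassign T B B-model v⁺

    ψ-holds⁺ : interp (Dom B) v⁺ ⊨ wit ⊤f
    ψ-holds⁺ = ⊨-coincidence (wit ⊤f)
      (λ x∈ → sym (pad-< _ M from (s≤s (All.lookup (xs≤max 0 W) (fv⊆vars (wit ⊤f) x∈)))))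
      (proj₂ witness)

    fresh : List ℕ
    fresh = applyUpTo (_+_ M) n

    covers : ∀ d → ∃ λ x → x ∈ fresh ++ W × v⁺ x ≡ d
    covers d = M + toℕ (to d)
             , ∈-++⁺ˡ (∈-applyUpTo⁺ (_+_ M) (toℕ<n (to d)))
             , trans (pad-+ _ M from (to d)) (strictlyInverseʳ d)

    n≤ : ∀ {t} → Labelling v⁺ (fresh ++ W) t → n ≤ t
    n≤ L = injective⇒≤ (Injection.injective (↔⇒↣ (↔-trans (↔-sym B↔n) (Labelling⇒↔ L covers))))

bounded⊎cofinite : LEM → ∀ {ℓ} (P : ℕ → Set ℓ) w → (∀ {n k} → w ≤ k → k ≤ n → P n → P k) →
  (∃ λ k → ∀ {n} → P n → n < k) ⊎ (∀ {n} → w ≤ n → P n)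
bounded⊎cofinite lem P w closed with lem (∃ λ k → w ≤ k × ¬ P k)
... | yes (k , w≤k , ¬Pk) = inj₁ (k , λ Pn → ℕ.≰⇒> λ k≤n → ¬Pk (closed w≤k k≤n Pn))
... | no  ∄k = inj₂ λ {n} w≤n → decidable-stable (lem (P n)) λ ¬Pn → ∄k (n , w≤n , ¬Pn)

module _ (lem : LEM) (T : Theory) where

  specCount≤ : ∀ m → specCount lem T m ≤ m
  specCount≤ zero = z≤n
  specCount≤ (suc m) with lem (InSpec T (suc m))
  ... | yes _ = s≤s (specCount≤ m)
  ... | no  _ = ℕ.m≤n⇒m≤1+n (specCount≤ m)

  specCount-bounded : ∀ {k} → (∀ {n} → InSpec T n → n < k) → ∀ m → specCount lem T m ≤ k
  specCount-bounded bounded zero = z≤n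
  specCount-bounded bounded (suc m) with lem (InSpec T (suc m))
  ... | yes 1+m∈ = ℕ.≤-trans (s≤s (specCount≤ m)) (ℕ.<⇒≤ (bounded 1+m∈))
  ... | no  _    = specCount-bounded bounded m

  specCount-cofinite : ∀ {w} → (∀ {n} → w ≤ n → InSpec T n) → ∀ m → m ≤ specCount lem T m + w
  specCount-cofinite cofinite zero = z≤n
  specCount-cofinite cofinite (suc m) with lem (InSpec T (suc m))
  ... | yes _    = s≤s (specCount-cofinite cofinite m)
  ... | no  1+m∉ = ℕ.≤-trans (ℕ.<⇒≤ (ℕ.≰⇒> (1+m∉ ∘ cofinite))) (ℕ.m≤n+m _ (specCount lem T m))

-- DensityIs lem T r unfolds to Tendsto (densitySeq lem T) r.
Tendsto : (ℕ → ℚ) → ℚ → Set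
Tendsto f r = ∀ ε → 0ℚ ℚ.< ε → ∃ λ N → ∀ m → N ≤ m → ℚ.∣ f m ℚ.- r ∣ ℚ.≤ ε

∣m⊖n∣≤o : ∀ {m n o} → m ≤ n + o → n ≤ m + o → ℤ.∣ m ⊖ n ∣ ≤ o
∣m⊖n∣≤o {m} {n} m≤n+o n≤m+o with ℕ.≤-total n m
... | inj₁ n≤m = subst (_≤ _) (sym (trans (ℤ.∣m⊖n∣≡∣n⊖m∣ m n) (ℤ.∣⊖∣-≤ n≤m)))
                       (ℕ.m≤n+o⇒m∸n≤o m n m≤n+o)
... | inj₂ m≤n = subst (_≤ _) (sym (ℤ.∣⊖∣-≤ m≤n)) (ℕ.m≤n+o⇒m∸n≤o n m n≤m+o)

∣m/d-n/d∣≤o/d : ∀ {m n o} d → m ≤ n + o → n ≤ m + o →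
  ℚᵘ.∣ mkℚᵘ (+ m) d ℚᵘ.- mkℚᵘ (+ n) d ∣ ℚᵘ.≤ mkℚᵘ (+ o) d
∣m/d-n/d∣≤o/d {m} {n} {o} d m≤n+o n≤m+o = *≤* (begin
  + ℤ.∣ + m ℤ.* + e ℤ.+ ℤ.- + n ℤ.* + e ∣ ℤ.* + e ≡⟨ cong (λ i → + ℤ.∣ i ∣ ℤ.* + e) numerator ⟩
  + ℤ.∣ (m ⊖ n) ℤ.* + e ∣ ℤ.* + e                  ≡⟨ cong (λ j → + j ℤ.* + e) (ℤ.abs-* (m ⊖ n) (+ e)) ⟩
  + (ℤ.∣ m ⊖ n ∣ ℕ.* e) ℤ.* + e                    ≡⟨ ℤ.pos-* (ℤ.∣ m ⊖ n ∣ ℕ.* e) e ⟨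
  + (ℤ.∣ m ⊖ n ∣ ℕ.* e ℕ.* e)                      ≡⟨ cong +_ (ℕ.*-assoc ℤ.∣ m ⊖ n ∣ e e) ⟩
  + (ℤ.∣ m ⊖ n ∣ ℕ.* (e ℕ.* e))                    ≤⟨ ℤ.+≤+ (ℕ.*-monoˡ-≤ (e ℕ.* e) ∣m⊖n∣≤o′) ⟩
  + (o ℕ.* (e ℕ.* e))                              ≡⟨ ℤ.pos-* o (e ℕ.* e) ⟩
  + o ℤ.* + (e ℕ.* e)                              ∎)
  where
  open ℤ.≤-Reasoning
  e = suc d
  ∣m⊖n∣≤o′ = ∣m⊖n∣≤o m≤n+o n≤m+o
  numerator : + m ℤ.* + e ℤ.+ ℤ.- + n ℤ.* + e ≡ (m ⊖ n) ℤ.* + e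
  numerator = trans (sym (ℤ.*-distribʳ-+ (+ e) (+ m) (ℤ.- + n))) (cong (ℤ._* + e) (ℤ.m-n≡m⊖n m n))

∣c/d-r∣≤ε : ∀ {c b C} d {r ε : ℚ} → toℚᵘ r ℚᵘ.≃ mkℚᵘ (+ b) d → c ≤ b + C → b ≤ c + C →
  mkℚᵘ (+ C) d ℚᵘ.≤ toℚᵘ ε → ℚ.∣ + c / suc d ℚ.- r ∣ ℚ.≤ ε
∣c/d-r∣≤ε {c} {b} d {r} r≃b/d c≤b+C b≤c+C C/d≤ε = ℚ.toℚᵘ-cancel-≤
  (ℚᵘ.≤-respˡ-≃ (ℚᵘ.≃-sym distance) (ℚᵘ.≤-trans (∣m/d-n/d∣≤o/d d c≤b+C b≤c+C) C/d≤ε))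
  where
  x = + c / suc d
  distance : toℚᵘ ℚ.∣ x ℚ.- r ∣ ℚᵘ.≃ ℚᵘ.∣ mkℚᵘ (+ c) d ℚᵘ.- mkℚᵘ (+ b) d ∣
  distance = ℚᵘ.≃-trans (ℚ.toℚᵘ-homo-∣-∣ (x ℚ.- r))
    (ℚᵘ.∣-∣-cong (ℚᵘ.≃-trans (ℚ.toℚᵘ-homo-+ x (ℚ.- r))
      (ℚᵘ.+-cong (ℚ.toℚᵘ-fromℚᵘ (mkℚᵘ (+ c) d))
                 (ℚᵘ.≃-trans (ℚ.toℚᵘ-homo‿- r) (ℚᵘ.-‿cong r≃b/d)))))

archimedean : ∀ C (ε : ℚ) → 0ℚ ℚ.< ε → ∃ λ N → ∀ m → N ≤ m → mkℚᵘ (+ C) m ℚᵘ.≤ toℚᵘ ε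
archimedean C (mkℚ +[1+ p ] d _) _ = C ℕ.* suc d , λ m N≤m →
  *≤* (subst₂ ℤ._≤_ (ℤ.pos-* C (suc d)) (ℤ.pos-* (suc p) (suc m))
    (ℤ.+≤+ (ℕ.≤-trans N≤m (ℕ.≤-trans (ℕ.n≤1+n m) (ℕ.m≤n*m (suc m) (suc p))))))
archimedean C (mkℚ (+ 0)    d _) (ℚ.*<* (ℤ.+<+ ()))
archimedean C (mkℚ -[1+ p ] d _) (ℚ.*<* ())

near-ratio-tendsto : ∀ (c b : ℕ → ℕ) C r → (∀ m → toℚᵘ r ℚᵘ.≃ mkℚᵘ (+ b m) m) →
  (∀ m → c m ≤ b m + C) → (∀ m → b m ≤ c m + C) → Tendsto (λ m → + c m / suc m) r
near-ratio-tendsto c b C r r≃b/m c≤b+C b≤c+C ε ε>0 =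
  let N , C/m≤ε = archimedean C ε ε>0
  in N , λ m N≤m → ∣c/d-r∣≤ε {b = b m} m (r≃b/m m) (c≤b+C m) (b≤c+C m) (C/m≤ε m N≤m)

bounded-ratio→0 : ∀ C (c : ℕ → ℕ) → (∀ m → c m ≤ C) → Tendsto (λ m → + c m / suc m) 0ℚ
bounded-ratio→0 C c c≤C = near-ratio-tendsto c (λ _ → 0) C 0ℚ (λ _ → *≡* refl) c≤C (λ _ → z≤n)

cobounded-ratio→1 : ∀ C (c : ℕ → ℕ) → (∀ m → c m ≤ suc m) → (∀ m → suc m ≤ c m + C) →
  Tendsto (λ m → + c m / suc m) 1ℚ
cobounded-ratio→1 C c c≤1+m 1+m≤c+C = near-ratio-tendsto c suc C 1ℚ
  (λ m → *≡* (ℤ.*-comm (+ 1) (+ suc m))) (λ m → ℕ.m≤n⇒m≤n+o C (c≤1+m m)) 1+m≤c+C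

theorem4 : (lem : LEM) (T : Theory) → StronglyFinitelyWitnessable T →
    DensityIs lem T 0ℚ ⊎ DensityIs lem T 1ℚ
theorem4 lem T S with bounded⊎cofinite lem (InSpec T) (witness-width S) (InSpec-interval S lem)
... | inj₁ (k , bounded) = inj₁ (bounded-ratio→0 k _ (specCount-bounded lem T bounded ∘ suc))
... | inj₂ cofinite     = inj₂ (cobounded-ratio→1 (witness-width S) _
  (specCount≤ lem T ∘ suc) (specCount-cofinite lem T cofinite ∘ suc))
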